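{- If $A$ is a rectifiable subset of an abelian group $G$, then for every finite subgroup $K\le G$ and every $g\in G$ we have $|A\cap(g+K)|\le\frac12(|K|+1)$.
   Context: A subset $S$ of an abelian group is rectifiable if there is a map $\lambda\colon S\to\mathbb{Z}$ such that for all $s_1,s_2,s_3,s_4\in S$ one has $s_1+s_2=s_3+s_4$ if and only if $\lambda(s_1)+\lambda(s_2)=\lambda(s_3)+\lambda(s_4)$. -}

module Defs where

open import Level using (Level; _⊔_)
open import Algebra.Bundles using (AbelianGroup)
open import Data.Nat using (ℕ; _*_; _+_; _≤_)
open import Data.Integer as ℤ using (ℤ)
open import Data.Fin using (Fin)
open import Data.List using (List; length)
open import Data.List.Relation.Unary.All using (All)
open import Data.List.Relation.Unary.AllPairs using (AllPairs)
open import Data.Product using (Σ; ∃; _×_)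
open import Relation.Nullary using (¬_)
open import Relation.Binary.PropositionalEquality using (_≡_)

module _ {c ℓ : Level} (G : AbelianGroup c ℓ) where
  open AbelianGroup G

  Rectifiable : {a : Level} → (Carrier → Set a) → Set (c ⊔ ℓ ⊔ a)
  Rectifiable S =
    Σ ((x : Carrier) → S x → ℤ) λ f →
      ∀ s₁ s₂ s₃ s₄ (p₁ : S s₁) (p₂ : S s₂) (p₃ : S s₃) (p₄ : S s₄) →
        ((s₁ ∙ s₂ ≈ s₃ ∙ s₄) → f s₁ p₁ ℤ.+ f s₂ p₂ ≡ f s₃ p₃ ℤ.+ f s₄ p₄)
        × (f s₁ p₁ ℤ.+ f s₂ p₂ ≡ f s₃ p₃ ℤ.+ f s₄ p₄ → (s₁ ∙ s₂ ≈ s₃ ∙ s₄))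

  record FiniteSubgroup : Set (c ⊔ ℓ) where
    field
      size      : ℕ
      elt       : Fin size → Carrier
      injective : ∀ i j → elt i ≈ elt j → i ≡ j
      has-ε     : ∃ λ i → ε ≈ elt i
      closed-∙  : ∀ i j → ∃ λ k → elt i ∙ elt j ≈ elt k
      closed-⁻¹ : ∀ i → ∃ λ k → elt i ⁻¹ ≈ elt k

    InCoset : Carrier → Carrier → Set ℓ
    InCoset g x = ∃ λ i → x ≈ g ∙ elt i

  -- |X| ≤ n for a (possibly non-decidable) subset X: every list of pairwise
  -- distinct elements of X has length ≤ n.  Here stated as 2|X| ≤ m.
  TwiceCardAtMost : {a : Level} → (Carrier → Set a) → ℕ → Set (c ⊔ ℓ ⊔ a)
  TwiceCardAtMost X m =
    (xs : List Carrier) → AllPairs (λ x y → ¬ (x ≈ y)) xs → All X xs →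
      2 * length xs ≤ m

-- Let x₀, …, xₙ be distinct elements of A in the coset g + K and let φ be a
-- rectification of A.  Take a with φ a minimal and b with φ b maximal.  The
-- n + 1 sums a + xⱼ and the n sums xₖ + b (xₖ ≠ a) are pairwise distinct: an
-- equality a + xⱼ = xₖ + b would force φ a + φ xⱼ = φ xₖ + φ b, hence
-- φ a = φ xₖ by extremality, hence a = xₖ since φ separates points.  These
-- 2n + 1 sums all lie in the coset 2g + K, which has |K| elements.
module Submission where

open import Defs
open import Level using (Level)
open import Algebra.Bundles using (AbelianGroup)
open import Data.Nat as ℕ using (ℕ; suc; z≤n; _+_)
import Data.Nat.Properties as ℕ
open import Data.Nat.Tactic.RingSolver using (solve-∀)
open import Data.Integer as ℤ using (ℤ)
import Data.Integer.Properties as ℤ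
open import Data.Fin using (Fin; zero; suc; punchIn; splitAt; join)
import Data.Fin.Properties as Fin
open import Data.List using (List; []; _∷_; length; lookup; allFin)
import Data.List.Relation.Unary.All as All
open import Data.List.Membership.Propositional.Properties using (∈-lookup; ∈-allFin)
open import Data.List.Relation.Unary.AllPairs using (_∷_)
open import Data.List.Relation.Unary.Unique.Setoid using (Unique)
import Data.List.Extrema ℤ.≤-totalOrder as Extrema
open import Data.Product using (_×_; _,_; proj₁; proj₂)
open import Data.Empty using (⊥-elim)
open import Data.Sum using (_⊎_; inj₁; inj₂)
open import Function using (_∘_; Injective)
open import Relation.Binary.Bundles using (Setoid)
open import Relation.Nullary using (¬_)
open import Relation.Binary.PropositionalEquality as ≡ using (_≡_)

lookup-injective : ∀ {s ℓ} (S : Setoid s ℓ) {xs : List (Setoid.Carrier S)} → Unique S xs →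
                   ∀ i j → Setoid._≈_ S (lookup xs i) (lookup xs j) → i ≡ j
lookup-injective S (_    ∷ _) zero    zero    _  = ≡.refl
lookup-injective S (x≉xs ∷ _) zero    (suc j) eq = ⊥-elim (All.lookup x≉xs (∈-lookup j) eq)
lookup-injective S (x≉xs ∷ _) (suc i) zero    eq = ⊥-elim (All.lookup x≉xs (∈-lookup i) (Setoid.sym S eq))
lookup-injective S (_ ∷ uniq) (suc i) (suc j) eq = ≡.cong suc (lookup-injective S uniq i j eq)

splitAt-injective : ∀ m {n} → Injective _≡_ _≡_ (splitAt m {n})
splitAt-injective m {n} {i} {j} eq = begin
  i                      ≡⟨ Fin.join-splitAt m n i ⟨
  join m n (splitAt m i) ≡⟨ ≡.cong (join m n) eq ⟩
  join m n (splitAt m j) ≡⟨ Fin.join-splitAt m n j ⟩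
  j                      ∎
  where open ≡.≡-Reasoning

+-mono-≤-equalityˡ : ∀ {a b c d : ℤ} → a ℤ.≤ c → b ℤ.≤ d → a ℤ.+ b ≡ c ℤ.+ d → a ≡ c
+-mono-≤-equalityˡ a≤c b≤d a+b≡c+d =
  ℤ.≤-antisym a≤c (ℤ.≮⇒≥ λ a<c → ℤ.<-irrefl a+b≡c+d (ℤ.+-mono-<-≤ a<c b≤d))

module _ {c ℓ : Level} (G : AbelianGroup c ℓ) where
  open AbelianGroup G
  open import Algebra.Properties.Group group using (∙-cancelˡ; ∙-cancelʳ)
  open import Algebra.Properties.CommutativeSemigroup commutativeSemigroup using (interchange)
  open import Relation.Binary.Reasoning.Setoid setoid

  module _ (K : FiniteSubgroup G) where
    open FiniteSubgroup K

    InCoset-∙ : ∀ {g h x y} → InCoset g x → InCoset h y → InCoset (g ∙ h) (x ∙ y)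
    InCoset-∙ {g} {h} {x} {y} (i , x≈gkᵢ) (j , y≈hkⱼ) with closed-∙ i j
    ... | k , kᵢkⱼ≈kₖ = k , (begin
      x ∙ y                     ≈⟨ ∙-cong x≈gkᵢ y≈hkⱼ ⟩
      (g ∙ elt i) ∙ (h ∙ elt j) ≈⟨ interchange g (elt i) h (elt j) ⟩
      (g ∙ h) ∙ (elt i ∙ elt j) ≈⟨ ∙-congˡ kᵢkⱼ≈kₖ ⟩
      (g ∙ h) ∙ elt k           ∎)

    InCoset-injective⇒≤ : ∀ {m h} (y : Fin m → Carrier) → (∀ i j → y i ≈ y j → i ≡ j) →
                          (∀ i → InCoset h (y i)) → m ℕ.≤ size
    InCoset-injective⇒≤ {h = h} y y-injective y∈h+K = Fin.injective⇒≤ index-injective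
      where
      index : Fin _ → Fin size
      index = proj₁ ∘ y∈h+K

      index-injective : Injective _≡_ _≡_ index
      index-injective {i} {j} eq = y-injective i j (begin
        y i               ≈⟨ proj₂ (y∈h+K i) ⟩
        h ∙ elt (index i) ≡⟨ ≡.cong (λ k → h ∙ elt k) eq ⟩
        h ∙ elt (index j) ≈⟨ proj₂ (y∈h+K j) ⟨
        y j               ∎)

  module _ {a : Level} {A : Carrier → Set a} (R : Rectifiable G A) where
    private
      φ : (x : Carrier) → A x → ℤ
      φ = proj₁ R

    φ-injective : ∀ {x y} (x∈A : A x) (y∈A : A y) → φ x x∈A ≡ φ y y∈A → x ≈ y
    φ-injective {x} {y} x∈A y∈A φx≡φy = ∙-cancelʳ y x y
      (proj₂ (proj₂ R x y y y x∈A y∈A y∈A y∈A) (≡.cong (ℤ._+ φ y y∈A) φx≡φy))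

    module DistinctSums {n : ℕ} (X : Fin (suc n) → Carrier) (X-injective : ∀ i j → X i ≈ X j → i ≡ j)
                        (X∈A : ∀ i → A (X i)) where

      v : Fin (suc n) → ℤ
      v i = φ (X i) (X∈A i)

      bottom top : Fin (suc n)
      bottom = Extrema.argmin v zero (allFin (suc n))
      top    = Extrema.argmax v zero (allFin (suc n))

      bottom-minimal : ∀ i → v bottom ℤ.≤ v i
      bottom-minimal i = All.lookup (Extrema.f[argmin]≤f[xs] {f = v} zero (allFin (suc n))) (∈-allFin i)

      top-maximal : ∀ i → v i ℤ.≤ v top
      top-maximal i = All.lookup (Extrema.f[xs]≤f[argmax] {f = v} zero (allFin (suc n))) (∈-allFin i)

      X-sum : Fin (suc n) × Fin (suc n) → Carrier
      X-sum (p , q) = X p ∙ X q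

      pair⊎ : Fin (suc n) ⊎ Fin n → Fin (suc n) × Fin (suc n)
      pair⊎ (inj₁ j) = bottom , j
      pair⊎ (inj₂ k) = punchIn bottom k , top

      bottom-sum≉top-sum : ∀ j k → ¬ (X bottom ∙ X j ≈ X (punchIn bottom k) ∙ X top)
      bottom-sum≉top-sum j k eq = Fin.punchInᵢ≢i bottom k (≡.sym (X-injective _ _
        (φ-injective _ _ (+-mono-≤-equalityˡ (bottom-minimal (punchIn bottom k)) (top-maximal j)
          (proj₁ (proj₂ R _ _ _ _ (X∈A bottom) (X∈A j) (X∈A (punchIn bottom k)) (X∈A top)) eq)))))

      pair⊎-distinct : ∀ u w → X-sum (pair⊎ u) ≈ X-sum (pair⊎ w) → u ≡ w
      pair⊎-distinct (inj₁ j) (inj₁ j′) eq = ≡.cong inj₁ (X-injective j j′ (∙-cancelˡ _ _ _ eq))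
      pair⊎-distinct (inj₂ k) (inj₂ k′) eq =
        ≡.cong inj₂ (Fin.punchIn-injective bottom k k′ (X-injective _ _ (∙-cancelʳ _ _ _ eq)))
      pair⊎-distinct (inj₁ j) (inj₂ k)  eq = ⊥-elim (bottom-sum≉top-sum j k eq)
      pair⊎-distinct (inj₂ k) (inj₁ j)  eq = ⊥-elim (bottom-sum≉top-sum j k (sym eq))

      pair : Fin (suc n + n) → Fin (suc n) × Fin (suc n)
      pair = pair⊎ ∘ splitAt (suc n)

      pair-distinct : ∀ u w → X-sum (pair u) ≈ X-sum (pair w) → u ≡ w
      pair-distinct u w eq = splitAt-injective (suc n) (pair⊎-distinct (splitAt (suc n) u) (splitAt (suc n) w) eq)

lemma7 : {c ℓ a : Level} (G : AbelianGroup c ℓ) (A : AbelianGroup.Carrier G → Set a) →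
    Rectifiable G A →
    (K : FiniteSubgroup G) (g : AbelianGroup.Carrier G) →
    TwiceCardAtMost G (λ x → A x × FiniteSubgroup.InCoset K g x) (FiniteSubgroup.size K + 1)
lemma7 G A R K g []       _        _           = z≤n
lemma7 G A R K g (x ∷ xs) distinct xs⊆A∩g+K = begin
  2 ℕ.* suc n   ≡⟨ twice-suc n ⟩
  suc n + n + 1 ≤⟨ ℕ.+-monoˡ-≤ 1 (InCoset-injective⇒≤ G K sum pair-distinct sum∈2g+K) ⟩
  size + 1      ∎
  where
  open AbelianGroup G
  open FiniteSubgroup K using (size; InCoset)
  open ℕ.≤-Reasoning

  n : ℕ
  n = length xs

  X : Fin (suc n) → Carrier
  X = lookup (x ∷ xs)

  X∈A∩g+K : ∀ i → A (X i) × InCoset g (X i)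
  X∈A∩g+K i = All.lookup xs⊆A∩g+K (∈-lookup i)

  open DistinctSums G R X (lookup-injective setoid distinct) (proj₁ ∘ X∈A∩g+K)
    using (X-sum; pair; pair-distinct)

  sum : Fin (suc n + n) → Carrier
  sum = X-sum ∘ pair

  sum∈2g+K : ∀ u → InCoset (g ∙ g) (sum u)
  sum∈2g+K u = InCoset-∙ G K (proj₂ (X∈A∩g+K (proj₁ (pair u)))) (proj₂ (X∈A∩g+K (proj₂ (pair u))))

  twice-suc : ∀ m → 2 ℕ.* suc m ≡ suc m + m + 1
  twice-suc = solve-∀
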